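{- Let $\omega = \tfrac12 + \tfrac{\sqrt{ -3}}{2}$ and $\mathcal{E}_{ -3} = \{ n \in \mathbb{Z}[\omega] : |n|^2 \le 1\}$. For every $n \in \mathbb{Z}[\omega] \setminus \mathcal{E}_{ -3}$ there exist nonzero $a,b,c \in \mathbb{Z}[\omega]$ with $\frac{4}{n} = \frac1a + \frac1b + \frac1c$.
   Context: $\mathbb{Z}[\omega]$ is the ring of Eisenstein integers, the ring of integers of $\mathbb{Q}(\sqrt{ -3})$; for $n = x + y\omega$ with $x,y\in\mathbb{Z}$, $|n|^2 = x^2 + xy + y^2$. -}

module Defs where

open import Data.Integer using (ℤ; _+_; _*_; _-_; _≤_; +_)
open import Relation.Binary.PropositionalEquality using (_≡_)
open import Relation.Nullary using (¬_)

-- Eisenstein integers x + y ω, with ω = 1/2 + √-3/2, so ω² = ω - 1.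
record 𝔼 : Set where
  constructor _+_ω
  field
    re : ℤ
    im : ℤ
open 𝔼 public

0𝔼 : 𝔼
0𝔼 = (+ 0) + (+ 0) ω

4𝔼 : 𝔼
4𝔼 = (+ 4) + (+ 0) ω

_+𝔼_ : 𝔼 → 𝔼 → 𝔼
(a + b ω) +𝔼 (c + d ω) = (a + c) + (b + d) ω

-- (a + bω)(c + dω) = ac + (ad + bc)ω + bd ω² = (ac - bd) + (ad + bc + bd)ω
_*𝔼_ : 𝔼 → 𝔼 → 𝔼
(a + b ω) *𝔼 (c + d ω) = (a * c - b * d) + (a * d + b * c + b * d) ω

norm : 𝔼 → ℤ
norm (x + y ω) = x * x + x * y + y * y

InE₋₃ : 𝔼 → Set
InE₋₃ n = norm n ≤ + 1

-- For nonzero n, a, b, c:  4/n = 1/a + 1/b + 1/c  ⇔  4abc = n(bc + ac + ab)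
-- (multiply both sides by nabc, valid in the field ℚ(ω)).
ErdosStraus : 𝔼 → 𝔼 → 𝔼 → 𝔼 → Set
ErdosStraus n a b c =
  4𝔼 *𝔼 ((a *𝔼 b) *𝔼 c) ≡ n *𝔼 (((b *𝔼 c) +𝔼 (a *𝔼 c)) +𝔼 (a *𝔼 b))

{-# OPTIONS --safe #-}
module Submission where

-- If n + w₁ + w₂ = 4a with units w₁, w₂ and a ≠ 0, then
-- 4/n = 1/a + 1/(n a w₁⁻¹) + 1/(n a w₂⁻¹).  Every class of ℤ[ω] modulo 4 contains minus a
-- sum of two units, so such a, w₁, w₂ exist for every n.  If a = 0 then n = -(w₁ + w₂) is
-- either a unit or zero, hence in 𝓔₋₃, or one of nine elements of norm 3 or 4 that are
-- solved explicitly.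

open import Algebra.Bundles using (CommutativeRing)

open import Defs

module _ {r ℓ} (R : CommutativeRing r ℓ) where

  open CommutativeRing R
  open import Algebra.Solver.Ring.NaturalCoefficients.Default commutativeSemiring
  open import Relation.Binary.Reasoning.Setoid setoid

  shift-by-multiple : ∀ {f ρ w q c} → ρ + w ≈ f * c → (ρ + f * q) + w ≈ f * (q + c)
  shift-by-multiple {f} {ρ} {w} {q} {c} ρ+w≈fc = begin
    (ρ + f * q) + w   ≈⟨ solve 4 (λ f ρ w q → (ρ :+ f :* q) :+ w := (ρ :+ w) :+ f :* q) refl f ρ w q ⟩
    (ρ + w) + f * q   ≈⟨ +-congʳ ρ+w≈fc ⟩
    f * c + f * q     ≈⟨ solve 3 (λ f q c → f :* c :+ f :* q := f :* (q :+ c)) refl f q c ⟩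
    f * (q + c)       ∎

  reciprocal-sum : ∀ {w₁ w₂ v₁ v₂} → w₁ * v₁ ≈ 1# → w₂ * v₂ ≈ 1# →
                   v₁ + v₂ ≈ (w₁ + w₂) * (v₁ * v₂)
  reciprocal-sum {w₁} {w₂} {v₁} {v₂} w₁v₁≈1 w₂v₂≈1 = begin
    v₁ + v₂                           ≈⟨ +-cong (*-identityˡ v₁) (*-identityˡ v₂) ⟨
    1# * v₁ + 1# * v₂                 ≈⟨ +-cong (*-congʳ w₂v₂≈1) (*-congʳ w₁v₁≈1) ⟨
    (w₂ * v₂) * v₁ + (w₁ * v₁) * v₂   ≈⟨ solve 4 (λ w₁ w₂ v₁ v₂ →
                                           (w₂ :* v₂) :* v₁ :+ (w₁ :* v₁) :* v₂ := (w₁ :+ w₂) :* (v₁ :* v₂))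
                                           refl w₁ w₂ v₁ v₂ ⟩
    (w₁ + w₂) * (v₁ * v₂)             ∎

  -- Denominators cleared in 1/a + 1/b + 1/c = 1/a + (w₁ + w₂)/(n a) = (n + w₁ + w₂)/(n a) = f/n.
  erdős-straus-identity : ∀ {f n a w₁ w₂ v₁ v₂} → w₁ * v₁ ≈ 1# → w₂ * v₂ ≈ 1# →
    n + (w₁ + w₂) ≈ f * a →
    let b = (n * a) * v₁ ; c = (n * a) * v₂ in
    f * ((a * b) * c) ≈ n * (((b * c) + (a * c)) + (a * b))
  erdős-straus-identity {f} {n} {a} {w₁} {w₂} {v₁} {v₂} w₁v₁≈1 w₂v₂≈1 n+w≈fa = begin
    f * ((a * b) * c)                             ≈⟨ solve 5 (λ f n a v₁ v₂ →
                                                       f :* ((a :* ((n :* a) :* v₁)) :* ((n :* a) :* v₂))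
                                                       := (n :* (n :* (a :* a))) :* ((f :* a) :* (v₁ :* v₂)))
                                                       refl f n a v₁ v₂ ⟩
    m * ((f * a) * (v₁ * v₂))                     ≈⟨ *-congˡ (*-congʳ n+w≈fa) ⟨
    m * ((n + (w₁ + w₂)) * (v₁ * v₂))             ≈⟨ *-congˡ (distribʳ _ _ _) ⟩
    m * (n * (v₁ * v₂) + (w₁ + w₂) * (v₁ * v₂))   ≈⟨ *-congˡ (+-congˡ (reciprocal-sum w₁v₁≈1 w₂v₂≈1)) ⟨
    m * (n * (v₁ * v₂) + (v₁ + v₂))               ≈⟨ solve 4 (λ n a v₁ v₂ →
                                                       (n :* (n :* (a :* a))) :* (n :* (v₁ :* v₂) :+ (v₁ :+ v₂))
                                                       := n :* ((((n :* a) :* v₁) :* ((n :* a) :* v₂) :+ a :* ((n :* a) :* v₂))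
                                                                :+ a :* ((n :* a) :* v₁)))
                                                       refl n a v₁ v₂ ⟩
    n * (((b * c) + (a * c)) + (a * b))           ∎
    where
    b = (n * a) * v₁
    c = (n * a) * v₂
    m = n * (n * (a * a))

open import Agda.Builtin.FromNat
open import Agda.Builtin.FromNeg
open import Algebra.Consequences.Propositional using (comm∧idˡ⇒idʳ; comm∧invˡ⇒invʳ; comm∧distrˡ⇒distrʳ)
open import Relation.Binary.PropositionalEquality
open import Algebra.Definitions {A = 𝔼} _≡_
  using (Associative; Commutative; LeftIdentity; LeftInverse; _DistributesOverˡ_)
open import Algebra.Properties.Ring using (+-inverseˡ-unique)
open import Algebra.Structures {A = 𝔼} _≡_ using (IsCommutativeRing)
open import Data.Integer using (+_; -[1+_]; 0ℤ; _+_; _*_; _-_; -_; _≤_; +≤+; _/_; _%_; _≟_)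
open import Data.Integer.DivMod using (n%d<d; a≡a%n+[a/n]*n)
import Data.Integer.Literals as ℤ
import Data.Integer.Properties as ℤ
open import Data.Integer.Tactic.RingSolver using (solve-∀)
open import Data.Nat as ℕ using (suc; z≤n; s≤s; _<_)
import Data.Nat.Literals as ℕ
open import Data.Product using (Σ; _×_; _,_; uncurry)
open import Data.Sum using (_⊎_; inj₁; inj₂; [_,_]′)
open import Data.Unit using (tt)
open import Function using (id; _∘_; flip)
open import Level using (0ℓ)
open import Relation.Binary.Definitions using (DecidableEquality)
open import Relation.Nullary using (¬_; yes; no; contradiction)
open import Relation.Nullary.Decidable using (map′; _×-dec_)

instance
  ℕ-number = ℕ.number
  ℤ-number = ℤ.number
  ℤ-negative = ℤ.negative

-𝔼_ : 𝔼 → 𝔼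
-𝔼 (x + y ω) = (- x) + (- y) ω

1𝔼 : 𝔼
1𝔼 = (+ 1) + (+ 0) ω

+𝔼-assoc : Associative _+𝔼_
+𝔼-assoc (a + b ω) (c + d ω) (e + f ω) = cong₂ _+_ω (ℤ.+-assoc a c e) (ℤ.+-assoc b d f)

+𝔼-comm : Commutative _+𝔼_
+𝔼-comm (a + b ω) (c + d ω) = cong₂ _+_ω (ℤ.+-comm a c) (ℤ.+-comm b d)

+𝔼-identityˡ : LeftIdentity 0𝔼 _+𝔼_
+𝔼-identityˡ (a + b ω) = cong₂ _+_ω (ℤ.+-identityˡ a) (ℤ.+-identityˡ b)

-𝔼-inverseˡ : LeftInverse 0𝔼 -𝔼_ _+𝔼_
-𝔼-inverseˡ (a + b ω) = cong₂ _+_ω (ℤ.+-inverseˡ a) (ℤ.+-inverseˡ b)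

*𝔼-assoc : Associative _*𝔼_
*𝔼-assoc (a + b ω) (c + d ω) (e + f ω) = cong₂ _+_ω (re≡ a b c d e f) (im≡ a b c d e f)
  where
  re≡ : ∀ a b c d e f → (a * c - b * d) * e - (a * d + b * c + b * d) * f
                     ≡ a * (c * e - d * f) - b * (c * f + d * e + d * f)
  re≡ = solve-∀
  im≡ : ∀ a b c d e f → (a * c - b * d) * f + (a * d + b * c + b * d) * e + (a * d + b * c + b * d) * f
                     ≡ a * (c * f + d * e + d * f) + b * (c * e - d * f) + b * (c * f + d * e + d * f)
  im≡ = solve-∀

*𝔼-comm : Commutative _*𝔼_
*𝔼-comm (a + b ω) (c + d ω) = cong₂ _+_ω (re≡ a b c d) (im≡ a b c d)
  where
  re≡ : ∀ a b c d → a * c - b * d ≡ c * a - d * b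
  re≡ = solve-∀
  im≡ : ∀ a b c d → a * d + b * c + b * d ≡ c * b + d * a + d * b
  im≡ = solve-∀

*𝔼-identityˡ : LeftIdentity 1𝔼 _*𝔼_
*𝔼-identityˡ (a + b ω) = cong₂ _+_ω (re≡ a b) (im≡ a b)
  where
  re≡ : ∀ a b → + 1 * a - + 0 * b ≡ a
  re≡ = solve-∀
  im≡ : ∀ a b → + 1 * b + + 0 * a + + 0 * b ≡ b
  im≡ = solve-∀

*𝔼-distribˡ : _*𝔼_ DistributesOverˡ _+𝔼_
*𝔼-distribˡ (a + b ω) (c + d ω) (e + f ω) = cong₂ _+_ω (re≡ a b c d e f) (im≡ a b c d e f)
  where
  re≡ : ∀ a b c d e f → a * (c + e) - b * (d + f) ≡ (a * c - b * d) + (a * e - b * f)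
  re≡ = solve-∀
  im≡ : ∀ a b c d e f → a * (d + f) + b * (c + e) + b * (d + f)
                     ≡ (a * d + b * c + b * d) + (a * f + b * e + b * f)
  im≡ = solve-∀

𝔼-isCommutativeRing : IsCommutativeRing _+𝔼_ _*𝔼_ -𝔼_ 0𝔼 1𝔼
𝔼-isCommutativeRing = record
  { isRing = record
    { +-isAbelianGroup = record
      { isGroup = record
        { isMonoid = record
          { isSemigroup = record
            { isMagma = record { isEquivalence = isEquivalence ; ∙-cong = cong₂ _+𝔼_ }
            ; assoc = +𝔼-assoc
            }
          ; identity = +𝔼-identityˡ , comm∧idˡ⇒idʳ +𝔼-comm +𝔼-identityˡ
          }
        ; inverse = -𝔼-inverseˡ , comm∧invˡ⇒invʳ +𝔼-comm -𝔼-inverseˡ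
        ; ⁻¹-cong = cong -𝔼_
        }
      ; comm = +𝔼-comm
      }
    ; *-cong = cong₂ _*𝔼_
    ; *-assoc = *𝔼-assoc
    ; *-identity = *𝔼-identityˡ , comm∧idˡ⇒idʳ *𝔼-comm *𝔼-identityˡ
    ; distrib = *𝔼-distribˡ , comm∧distrˡ⇒distrʳ *𝔼-comm *𝔼-distribˡ
    }
  ; *-comm = *𝔼-comm
  }

𝔼-commutativeRing : CommutativeRing 0ℓ 0ℓ
𝔼-commutativeRing = record { isCommutativeRing = 𝔼-isCommutativeRing }

open CommutativeRing 𝔼-commutativeRing using (zeroʳ; ring)

_≟𝔼_ : DecidableEquality 𝔼
(a + b ω) ≟𝔼 (c + d ω) =
  map′ (uncurry (cong₂ _+_ω)) (λ eq → cong re eq , cong im eq) ((a ≟ c) ×-dec (b ≟ d))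

norm-* : ∀ x y → norm (x *𝔼 y) ≡ norm x * norm y
norm-* (a + b ω) (c + d ω) = multiplicative a b c d
  where
  multiplicative : ∀ a b c d →
    (a * c - b * d) * (a * c - b * d) + (a * c - b * d) * (a * d + b * c + b * d)
      + (a * d + b * c + b * d) * (a * d + b * c + b * d)
    ≡ (a * a + a * b + b * b) * (c * c + c * d + d * d)
  multiplicative = solve-∀

0≤i*i : ∀ i → 0ℤ ≤ i * i
0≤i*i (+ m)    = subst (0ℤ ≤_) (sym (ℤ.+◃n≡+n (m ℕ.* m))) (+≤+ z≤n)
0≤i*i -[1+ m ] = +≤+ z≤n

i*i+3j*j≡0⇒j≡0 : ∀ i j → i * i + + 3 * (j * j) ≡ 0ℤ → j ≡ 0ℤ
i*i+3j*j≡0⇒j≡0 i j eq = i*i≡0⇒i≡0 j ([ (λ ()) , id ]′ (ℤ.i*j≡0⇒i≡0∨j≡0 (+ 3) 3j²≡0))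
  where
  open ℤ.≤-Reasoning
  i*i≡0⇒i≡0 : ∀ i → i * i ≡ 0ℤ → i ≡ 0ℤ
  i*i≡0⇒i≡0 i i*i≡0 = [ id , id ]′ (ℤ.i*j≡0⇒i≡0∨j≡0 i i*i≡0)
  3j²≤0 : + 3 * (j * j) ≤ 0ℤ
  3j²≤0 = begin
    + 3 * (j * j)           ≡⟨ ℤ.+-identityˡ _ ⟨
    0ℤ + + 3 * (j * j)      ≤⟨ ℤ.+-monoˡ-≤ (+ 3 * (j * j)) (0≤i*i i) ⟩
    i * i + + 3 * (j * j)   ≡⟨ eq ⟩
    0ℤ                      ∎
  3j²≡0 : + 3 * (j * j) ≡ 0ℤ
  3j²≡0 = ℤ.≤-antisym 3j²≤0 (ℤ.*-monoˡ-≤-nonNeg (+ 3) (0≤i*i j))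

norm≡0⇒≡0 : ∀ x → norm x ≡ 0ℤ → x ≡ 0𝔼
norm≡0⇒≡0 (a + b ω) N≡0 =
  cong₂ _+_ω (i*i+3j*j≡0⇒j≡0 (a + + 2 * b) a (trans (sym (four-norm′ a b)) 4N≡0))
             (i*i+3j*j≡0⇒j≡0 (+ 2 * a + b) b (trans (sym (four-norm a b)) 4N≡0))
  where
  4N≡0 : + 4 * norm (a + b ω) ≡ 0ℤ
  4N≡0 = cong (+ 4 *_) N≡0
  four-norm : ∀ a b → + 4 * (a * a + a * b + b * b) ≡ (+ 2 * a + b) * (+ 2 * a + b) + + 3 * (b * b)
  four-norm = solve-∀
  four-norm′ : ∀ a b → + 4 * (a * a + a * b + b * b) ≡ (a + + 2 * b) * (a + + 2 * b) + + 3 * (a * a)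
  four-norm′ = solve-∀

*𝔼-≢0 : ∀ {x y} → x ≢ 0𝔼 → y ≢ 0𝔼 → x *𝔼 y ≢ 0𝔼
*𝔼-≢0 {x} {y} x≢0 y≢0 xy≡0 =
  [ x≢0 ∘ norm≡0⇒≡0 x , y≢0 ∘ norm≡0⇒≡0 y ]′
    (ℤ.i*j≡0⇒i≡0∨j≡0 (norm x) (trans (sym (norm-* x y)) (cong norm xy≡0)))

ErdosStrausSolvable : 𝔼 → Set
ErdosStrausSolvable n = Σ 𝔼 λ a → Σ 𝔼 λ b → Σ 𝔼 λ c →
  ¬ a ≡ 0𝔼 × ¬ b ≡ 0𝔼 × ¬ c ≡ 0𝔼 × ErdosStraus n a b c

record 𝔼ˣ : Set where
  constructor unit
  field
    val inv : 𝔼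
    val*inv≡1 : val *𝔼 inv ≡ 1𝔼

open 𝔼ˣ

inv≢0 : (u : 𝔼ˣ) → inv u ≢ 0𝔼
inv≢0 (unit w v w*v≡1) refl = contradiction (trans (sym (zeroʳ w)) w*v≡1) λ ()

ω⁰ ω¹ ω² ω³ ω⁴ ω⁵ : 𝔼ˣ
ω⁰ = unit (1 + 0 ω) (1 + 0 ω) refl
ω¹ = unit (0 + 1 ω) (1 + -1 ω) refl
ω² = unit (-1 + 1 ω) (0 + -1 ω) refl
ω³ = unit (-1 + 0 ω) (-1 + 0 ω) refl
ω⁴ = unit (0 + -1 ω) (-1 + 1 ω) refl
ω⁵ = unit (1 + -1 ω) (0 + 1 ω) refl

record Expansion (n : 𝔼) : Set where
  constructor expansion
  field
    w₁ w₂ : 𝔼ˣ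
    a : 𝔼
    n+w₁+w₂≡4a : n +𝔼 (val w₁ +𝔼 val w₂) ≡ 4𝔼 *𝔼 a
    -[w₁+w₂]∈E⊎solvable : InE₋₃ (-𝔼 (val w₁ +𝔼 val w₂)) ⊎ ErdosStrausSolvable (-𝔼 (val w₁ +𝔼 val w₂))

erdős-straus-from-expansion : ∀ {n} → n ≢ 0𝔼 → (e : Expansion n) → Expansion.a e ≢ 0𝔼 →
                              ErdosStrausSolvable n
erdős-straus-from-expansion {n} n≢0 (expansion w₁ w₂ a n+w≡4a _) a≢0 =
  a , (n *𝔼 a) *𝔼 inv w₁ , (n *𝔼 a) *𝔼 inv w₂ ,
  a≢0 , *𝔼-≢0 na≢0 (inv≢0 w₁) , *𝔼-≢0 na≢0 (inv≢0 w₂) ,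
  erdős-straus-identity 𝔼-commutativeRing {4𝔼} {n} {a} {val w₁} {val w₂} {inv w₁} {inv w₂}
    (val*inv≡1 w₁) (val*inv≡1 w₂) n+w≡4a
  where
  na≢0 : n *𝔼 a ≢ 0𝔼
  na≢0 = *𝔼-≢0 n≢0 a≢0

degenerate-expansion : ∀ {n} (e : Expansion n) → Expansion.a e ≡ 0𝔼 →
                       InE₋₃ n ⊎ ErdosStrausSolvable n
degenerate-expansion {n} (expansion w₁ w₂ a n+w≡4a -w∈E⊎solvable) a≡0 =
  subst (λ m → InE₋₃ m ⊎ ErdosStrausSolvable m) (sym n≡-w) -w∈E⊎solvable
  where
  n≡-w : n ≡ -𝔼 (val w₁ +𝔼 val w₂)
  n≡-w = +-inverseˡ-unique ring n (val w₁ +𝔼 val w₂) (trans n+w≡4a (cong (4𝔼 *𝔼_) a≡0))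

expansion-+4* : ∀ {ρ} q → Expansion ρ → Expansion (ρ +𝔼 (4𝔼 *𝔼 q))
expansion-+4* {ρ} q (expansion w₁ w₂ c ρ+w≡4c -w∈E⊎solvable) =
  expansion w₁ w₂ (q +𝔼 c)
    (shift-by-multiple 𝔼-commutativeRing {4𝔼} {ρ} {val w₁ +𝔼 val w₂} {q} {c} ρ+w≡4c)
    -w∈E⊎solvable

-- The sixteen classes modulo 4 are 0, the six units, the three classes 2u ≡ -2u and the six
-- associates of 1 + ω.  For n of norm 3 the solution is 4/n = 1/n + n̄, where n̄ = 3/n is
-- again a sum of two units.
residue-expansion : ∀ r s → r < 4 → s < 4 → Expansion ((+ r) + (+ s) ω)
residue-expansion 0 0 _ _ = expansion ω⁰ ω³ (0 + 0 ω) refl (inj₁ (+≤+ z≤n))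
residue-expansion 0 1 _ _ = expansion ω³ ω⁵ (0 + 0 ω) refl (inj₁ ℤ.≤-refl)
residue-expansion 0 2 _ _ = expansion ω⁴ ω⁴ (0 + 0 ω) refl
  (inj₂ ((0 + 1 ω) , (0 + 2 ω) , (0 + 2 ω) , (λ ()) , (λ ()) , (λ ()) , refl))
residue-expansion 0 3 _ _ = expansion ω⁰ ω² (0 + 1 ω) refl (inj₁ ℤ.≤-refl)
residue-expansion 1 0 _ _ = expansion ω² ω⁴ (0 + 0 ω) refl (inj₁ ℤ.≤-refl)
residue-expansion 1 1 _ _ = expansion ω³ ω⁴ (0 + 0 ω) refl
  (inj₂ ((1 + 1 ω) , (0 + 1 ω) , (1 + 0 ω) , (λ ()) , (λ ()) , (λ ()) , refl))
residue-expansion 1 2 _ _ = expansion ω¹ ω² (0 + 1 ω) refl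
  (inj₂ ((1 + -2 ω) , (1 + -1 ω) , (0 + -1 ω) , (λ ()) , (λ ()) , (λ ()) , refl))
residue-expansion 1 3 _ _ = expansion ω¹ ω³ (0 + 1 ω) refl (inj₁ ℤ.≤-refl)
residue-expansion 2 0 _ _ = expansion ω³ ω³ (0 + 0 ω) refl
  (inj₂ ((1 + 0 ω) , (2 + 0 ω) , (2 + 0 ω) , (λ ()) , (λ ()) , (λ ()) , refl))
residue-expansion 2 1 _ _ = expansion ω⁵ ω⁰ (1 + 0 ω) refl
  (inj₂ ((-2 + 1 ω) , (-1 + 0 ω) , (-1 + 1 ω) , (λ ()) , (λ ()) , (λ ()) , refl))
residue-expansion 2 2 _ _ = expansion ω² ω² (0 + 1 ω) refl
  (inj₂ ((1 + -1 ω) , (2 + -2 ω) , (2 + -2 ω) , (λ ()) , (λ ()) , (λ ()) , refl))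
residue-expansion 2 3 _ _ = expansion ω² ω³ (0 + 1 ω) refl
  (inj₂ ((2 + -1 ω) , (1 + 0 ω) , (1 + -1 ω) , (λ ()) , (λ ()) , (λ ()) , refl))
residue-expansion 3 0 _ _ = expansion ω¹ ω⁵ (1 + 0 ω) refl (inj₁ ℤ.≤-refl)
residue-expansion 3 1 _ _ = expansion ω⁴ ω⁰ (1 + 0 ω) refl (inj₁ ℤ.≤-refl)
residue-expansion 3 2 _ _ = expansion ω⁴ ω⁵ (1 + 0 ω) refl
  (inj₂ ((-1 + 2 ω) , (-1 + 1 ω) , (0 + 1 ω) , (λ ()) , (λ ()) , (λ ()) , refl))
residue-expansion 3 3 _ _ = expansion ω⁰ ω¹ (1 + 1 ω) refl
  (inj₂ ((-1 + -1 ω) , (0 + -1 ω) , (-1 + 0 ω) , (λ ()) , (λ ()) , (λ ()) , refl))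
residue-expansion (suc (suc (suc (suc _)))) _ (s≤s (s≤s (s≤s (s≤s ())))) _
residue-expansion _ (suc (suc (suc (suc _)))) _ (s≤s (s≤s (s≤s (s≤s ()))))

divMod-4 : ∀ x y → x + y ω ≡ ((+ (x % 4)) + (+ (y % 4)) ω) +𝔼 (4𝔼 *𝔼 ((x / 4) + (y / 4) ω))
divMod-4 x y = cong₂ _+_ω
  (trans (a≡a%n+[a/n]*n x 4) (re≡ (+ (x % 4)) (x / 4) (y / 4)))
  (trans (a≡a%n+[a/n]*n y 4) (im≡ (+ (y % 4)) (x / 4) (y / 4)))
  where
  re≡ : ∀ r X Y → r + X * + 4 ≡ r + (+ 4 * X - + 0 * Y)
  re≡ = solve-∀
  im≡ : ∀ s X Y → s + Y * + 4 ≡ s + (+ 4 * Y + + 0 * X + + 0 * Y)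
  im≡ = solve-∀

expansion-of : ∀ n → Expansion n
expansion-of (x + y ω) = subst Expansion (sym (divMod-4 x y))
  (expansion-+4* ((x / 4) + (y / 4) ω) (residue-expansion (x % 4) (y % 4) (n%d<d x 4) (n%d<d y 4)))

theorem12 : (n : 𝔼) → ¬ InE₋₃ n →
    Σ 𝔼 λ a → Σ 𝔼 λ b → Σ 𝔼 λ c →
      ¬ a ≡ 0𝔼 × ¬ b ≡ 0𝔼 × ¬ c ≡ 0𝔼 × ErdosStraus n a b c
theorem12 n n∉E = solvable (expansion-of n)
  where
  solvable : Expansion n → ErdosStrausSolvable n
  solvable e with Expansion.a e ≟𝔼 0𝔼
  ... | no a≢0  = erdős-straus-from-expansion (λ { refl → n∉E (+≤+ z≤n) }) e a≢0
  ... | yes a≡0 = [ flip contradiction n∉E , id ]′ (degenerate-expansion e a≡0)
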